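{- There exist a residuated lattice $A$ and a filter $F$ of $A$ such that $Ds(A/F)\neq Ds(A)/F$.
   Context: A (commutative) residuated lattice is an algebra $(A,\vee,\wedge,\odot,\rightarrow,0,1)$ such that $(A,\vee,\wedge,0,1)$ is a bounded lattice, $(A,\odot,1)$ is a commutative monoid, and for all $a,b,c\in A$: $a\le b\rightarrow c$ iff $a\odot b\le c$. Write $\neg a=a\rightarrow 0$ and $a\leftrightarrow b=(a\rightarrow b)\wedge(b\rightarrow a)$. A filter of $A$ is a nonempty subset closed under $\odot$ and upward closed. $Ds(A)=\{a\in A\mid \neg a=0\}$. For a filter $F$, $a\equiv b\pmod F$ iff $a\leftrightarrow b\in F$; $A/F$ is the quotient residuated lattice with elements $a/F$, and $X/F=\{x/F\mid x\in X\}$ for $X\subseteq A$. -}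

module Defs where

open import Level using (0ℓ)
open import Data.Product using (Σ; _×_; ∃; _,_)
open import Relation.Binary.PropositionalEquality using (_≡_)
open import Function.Bundles using (_⇔_)

record ResLattice : Set₁ where
  infixr 6 _∨_
  infixr 7 _∧_
  infixr 7 _⊙_
  infixr 5 _⇒_
  field
    Carrier : Set
    _∨_ _∧_ _⊙_ _⇒_ : Carrier → Carrier → Carrier
    𝟘 𝟙 : Carrier
    ∨-comm  : ∀ a b → a ∨ b ≡ b ∨ a
    ∧-comm  : ∀ a b → a ∧ b ≡ b ∧ a
    ∨-assoc : ∀ a b c → (a ∨ b) ∨ c ≡ a ∨ (b ∨ c)
    ∧-assoc : ∀ a b c → (a ∧ b) ∧ c ≡ a ∧ (b ∧ c)
    ∨-absorbs-∧ : ∀ a b → a ∨ (a ∧ b) ≡ a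
    ∧-absorbs-∨ : ∀ a b → a ∧ (a ∨ b) ≡ a
  _≤_ : Carrier → Carrier → Set
  a ≤ b = a ∧ b ≡ a
  field
    𝟘-least    : ∀ a → 𝟘 ≤ a
    𝟙-greatest : ∀ a → a ≤ 𝟙
    ⊙-assoc    : ∀ a b c → (a ⊙ b) ⊙ c ≡ a ⊙ (b ⊙ c)
    ⊙-comm     : ∀ a b → a ⊙ b ≡ b ⊙ a
    ⊙-identity : ∀ a → 𝟙 ⊙ a ≡ a
    residuation : ∀ a b c → (a ≤ (b ⇒ c)) ⇔ ((a ⊙ b) ≤ c)

  ¬_ : Carrier → Carrier
  ¬ a = a ⇒ 𝟘

  _⇔ₐ_ : Carrier → Carrier → Carrier
  a ⇔ₐ b = (a ⇒ b) ∧ (b ⇒ a)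

  Ds : Carrier → Set
  Ds a = ¬ a ≡ 𝟘

module _ (A : ResLattice) where
  open ResLattice A

  record IsFilter (F : Carrier → Set) : Set where
    field
      nonempty : Σ Carrier F
      ⊙-closed : ∀ a b → F a → F b → F (a ⊙ b)
      up-closed : ∀ a b → F a → a ≤ b → F b

  _≡[_]_ : Carrier → (Carrier → Set) → Carrier → Set
  a ≡[ F ] b = F (a ⇔ₐ b)

  -- Membership of the class x/F in Ds(A/F): ¬(x/F) = 0/F in A/F,
  -- i.e. (¬ x) ≡ 0 (mod F) (operations of A/F act on representatives).
  InDsQuot : (Carrier → Set) → Carrier → Set
  InDsQuot F x = (¬ x) ≡[ F ] 𝟘

  -- Membership of the class x/F in Ds(A)/F = { y/F | y ∈ Ds(A) }:
  -- some y ∈ Ds(A) has y/F = x/F.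
  InDsModF : (Carrier → Set) → Carrier → Set
  InDsModF F x = Σ Carrier (λ y → Ds y × (y ≡[ F ] x))

-- In the five-element chain 0 < a < b < c < 1 whose product is the meet on
-- {b, c, 1}, while a ⊙ y = 0 for every y < 1, the only dense element is 1.
-- Modulo the principal filter ↑c we get ¬b = a ≡ 0, so b/F ∈ Ds(A/F);
-- but b/F ≠ 1/F, since 1 ↔ b = b ∉ ↑c.
module Submission where

open import Defs
open import Data.Bool using (if_then_else_)
open import Data.Fin using (Fin; zero; suc)
open import Data.Fin.Properties using (_≟_; _≤?_; all?)
open import Data.Product using (Σ; _×_; _,_)
open import Function.Bundles using (_⇔_; mk⇔; Equivalence)
open import Relation.Nullary using (¬_; Dec; does; map′; _×-dec_; _→-dec_)
open import Relation.Nullary.Decidable using (from-yes)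
open import Relation.Binary.PropositionalEquality using (_≡_; refl; sym; cong; subst₂)
open Relation.Binary.PropositionalEquality.≡-Reasoning

_⇔-dec_ : ∀ {P Q : Set} → Dec P → Dec Q → Dec (P ⇔ Q)
p? ⇔-dec q? = map′ (λ (f , g) → mk⇔ f g) (λ e → Equivalence.to e , Equivalence.from e)
                   ((p? →-dec q?) ×-dec (q? →-dec p?))

module _ (A : ResLattice) where
  open ResLattice A

  ≤-refl : ∀ x → x ≤ x
  ≤-refl x = begin
    x ∧ x             ≡⟨ cong (x ∧_) (sym (∨-absorbs-∧ x x)) ⟩
    x ∧ (x ∨ (x ∧ x)) ≡⟨ ∧-absorbs-∨ x (x ∧ x) ⟩
    x                 ∎

  ≤-reflexive : ∀ {x y} → x ≡ y → x ≤ y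
  ≤-reflexive {x} refl = ≤-refl x

  ≤-trans : ∀ {x y z} → x ≤ y → y ≤ z → x ≤ z
  ≤-trans {x} {y} {z} x≤y y≤z = begin
    x ∧ z       ≡⟨ cong (_∧ z) (sym x≤y) ⟩
    (x ∧ y) ∧ z ≡⟨ ∧-assoc x y z ⟩
    x ∧ (y ∧ z) ≡⟨ cong (x ∧_) y≤z ⟩
    x ∧ y       ≡⟨ x≤y ⟩
    x           ∎

  ⊙-monoˡ-≤ : ∀ {x y} z → x ≤ y → (x ⊙ z) ≤ (y ⊙ z)
  ⊙-monoˡ-≤ {x} {y} z x≤y =
    Equivalence.to (residuation x z (y ⊙ z))
      (≤-trans x≤y (Equivalence.from (residuation y z (y ⊙ z)) (≤-refl (y ⊙ z))))

  ⊙-monoʳ-≤ : ∀ {x y} z → x ≤ y → (z ⊙ x) ≤ (z ⊙ y)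
  ⊙-monoʳ-≤ {x} {y} z x≤y =
    subst₂ _≤_ (⊙-comm x z) (⊙-comm y z) (⊙-monoˡ-≤ z x≤y)

  ↑-isFilter : ∀ e → e ⊙ e ≡ e → IsFilter A (e ≤_)
  ↑-isFilter e e⊙e≡e = record
    { nonempty  = e , ≤-refl e
    ; ⊙-closed  = λ x y e≤x e≤y →
        ≤-trans (≤-trans (≤-reflexive (sym e⊙e≡e)) (⊙-monoˡ-≤ e e≤x)) (⊙-monoʳ-≤ x e≤y)
    ; up-closed = λ x y e≤x x≤y → ≤-trans e≤x x≤y
    }

C₅ : Set
C₅ = Fin 5

pattern bot = zero
pattern a   = suc zero
pattern b   = suc (suc zero)
pattern c   = suc (suc (suc zero))
pattern top = suc (suc (suc (suc zero)))

_⊓_ _⊔_ _⊙_ _⇒_ : C₅ → C₅ → C₅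
x ⊓ y = if does (x ≤? y) then x else y
x ⊔ y = if does (x ≤? y) then y else x

top ⊙ y   = y
x   ⊙ top = x
a   ⊙ _   = bot
_   ⊙ a   = bot
x   ⊙ y   = x ⊓ y

bot ⇒ _   = top
_   ⇒ top = top
top ⇒ y   = y
a   ⇒ bot = c
a   ⇒ _   = top
b   ⇒ b   = top
b   ⇒ c   = top
c   ⇒ c   = top
c   ⇒ b   = b
_   ⇒ _   = a

A₅ : ResLattice
A₅ = record
  { Carrier = C₅ ; _∨_ = _⊔_ ; _∧_ = _⊓_ ; _⊙_ = _⊙_ ; _⇒_ = _⇒_ ; 𝟘 = bot ; 𝟙 = top
  ; ∨-comm      = from-yes (all? λ x → all? λ y → x ⊔ y ≟ y ⊔ x)
  ; ∧-comm      = from-yes (all? λ x → all? λ y → x ⊓ y ≟ y ⊓ x)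
  ; ∨-assoc     = from-yes (all? λ x → all? λ y → all? λ z → (x ⊔ y) ⊔ z ≟ x ⊔ (y ⊔ z))
  ; ∧-assoc     = from-yes (all? λ x → all? λ y → all? λ z → (x ⊓ y) ⊓ z ≟ x ⊓ (y ⊓ z))
  ; ∨-absorbs-∧ = from-yes (all? λ x → all? λ y → x ⊔ (x ⊓ y) ≟ x)
  ; ∧-absorbs-∨ = from-yes (all? λ x → all? λ y → x ⊓ (x ⊔ y) ≟ x)
  ; 𝟘-least     = from-yes (all? λ x → bot ⊓ x ≟ bot)
  ; 𝟙-greatest  = from-yes (all? λ x → x ⊓ top ≟ x)
  ; ⊙-assoc     = from-yes (all? λ x → all? λ y → all? λ z → (x ⊙ y) ⊙ z ≟ x ⊙ (y ⊙ z))
  ; ⊙-comm      = from-yes (all? λ x → all? λ y → x ⊙ y ≟ y ⊙ x)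
  ; ⊙-identity  = from-yes (all? λ x → top ⊙ x ≟ x)
  ; residuation = from-yes (all? λ x → all? λ y → all? λ z →
                    (x ⊓ (y ⇒ z) ≟ x) ⇔-dec ((x ⊙ y) ⊓ z ≟ x ⊙ y))
  }

↑c : C₅ → Set
↑c = ResLattice._≤_ A₅ c

dense⇒top : ∀ y → ResLattice.Ds A₅ y → y ≡ top
dense⇒top top _ = refl
dense⇒top bot ()
dense⇒top a   ()
dense⇒top b   ()
dense⇒top c   ()

b∈Ds[A/F] : InDsQuot A₅ ↑c b
b∈Ds[A/F] = refl

b∉Ds[A]/F : ¬ InDsModF A₅ ↑c b
b∉Ds[A]/F (y , y-dense , y≡b) with dense⇒top y y-dense
b∉Ds[A]/F (top , _ , ()) | refl

proposition3p3 : Σ ResLattice (λ A → Σ (ResLattice.Carrier A → Set) (λ F → IsFilter A F × ¬ (∀ x → (InDsQuot A F x ⇔ InDsModF A F x))))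
proposition3p3 =
  A₅ , ↑c , ↑-isFilter A₅ c refl ,
  λ Ds[A/F]≡Ds[A]/F → b∉Ds[A]/F (Equivalence.to (Ds[A/F]≡Ds[A]/F b) b∈Ds[A/F])
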